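{- For every $m \in \mathbb{N}$, every $g \in \mathcal{G}(m)$ belongs to $\mathcal{G}_s$ for some $s \le (m+1)^2/4$.
   Context: For $s \ge 1$, $\mathcal{G}_s$ is the set of multilinear polynomials of degree at most $2$ in the variables $x_1,\ldots,x_s$ with all coefficients in $\{0,1\}$ and zero constant term, and $\mathcal{G} = \bigsqcup_{s \ge 1} \mathcal{G}_s$. For $m \in \mathbb{N}$, $\mathcal{G}(m) \subseteq \mathcal{G}$ is the set of $g \in \mathcal{G}_s$ (for some $s$) such that for every variable $x_i$, $i \in [s]$, the polynomial $g_i$ obtained from $g$ by substituting $x_i = 1$ does not belong to $\mathcal{G}$ and has fewer than $m$ nonzero linear terms. -}

module Defs where

open import Data.Nat using (ℕ; zero; suc; _≤_; _<_; _≟_)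
open import Data.Bool using (Bool; true; false; if_then_else_; _∨_)
open import Data.Fin using (Fin)
open import Data.Fin.Properties using () renaming (_≟_ to _≟ᶠ_)
open import Data.List using (List; length; filter)
open import Data.List.Base using (allFin)
open import Data.Product using (_×_)
open import Relation.Nullary using (¬_; ¬?; does)
open import Relation.Binary.PropositionalEquality using (_≡_)

-- An element of 𝒢_s: a multilinear polynomial of degree ≤ 2 in x_1..x_s with
-- coefficients in {0,1} and zero constant term.  It is determined by
--   lin i      = coefficient of x_i            (in {0,1} ≅ Bool)
--   quad i j   = coefficient of x_i x_j (i ≠ j), stored symmetrically,
--                with quad i i = false (multilinearity).
record G (s : ℕ) : Set where
  field
    lin    : Fin s → Bool
    quad   : Fin s → Fin s → Bool
    quad-sym     : ∀ i j → quad i j ≡ quad j i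
    quad-irrefl  : ∀ i → quad i i ≡ false
open G public

-- General multilinear polynomial of degree ≤ 2 in x_1..x_s with natural
-- number coefficients (enough to hold the result of substituting x_i = 1).
record Poly2 (s : ℕ) : Set where
  field
    const  : ℕ
    lin    : Fin s → ℕ
    quad   : Fin s → Fin s → ℕ
open Poly2 public

b2n : Bool → ℕ
b2n true  = 1
b2n false = 0

InG : ∀ {s} → Poly2 s → Set
InG p = (Poly2.const p ≡ 0)
      × (∀ j → Poly2.lin p j ≤ 1)
      × (∀ j k → Poly2.quad p j k ≤ 1)

substOne : ∀ {s} → G s → Fin s → Poly2 s
Poly2.const (substOne g i) = b2n (G.lin g i)
Poly2.lin   (substOne g i) j =
  if does (j ≟ᶠ i) then 0 else b2n (G.lin g j) Data.Nat.+ b2n (G.quad g i j)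
Poly2.quad  (substOne g i) j k =
  if does (j ≟ᶠ i) ∨ does (k ≟ᶠ i) then 0 else b2n (G.quad g j k)

numLin : ∀ {s} → Poly2 s → ℕ
numLin {s} p = length (filter (λ j → ¬? (Poly2.lin p j ≟ 0)) (allFin s))

InGm : ∀ {s} → ℕ → G s → Set
InGm m g = ∀ i → ¬ InG (substOne g i) × numLin (substOne g i) < m

{-# OPTIONS --safe #-}
-- Call x_j linear if g contains the term x_j.  Substituting x_i = 1 for a
-- nonlinear x_i leaves the constant term 0, so g_i ∉ 𝒢 forces a coefficient 2,
-- i.e. a monomial x_i x_j with x_j linear: every variable is linear or hangs off
-- a linear one.  For linear x_j, g_j has a nonzero linear term at every other
-- linear variable and at every nonlinear neighbour of x_j, so with a linear
-- variables each linear x_j carries at most m - a nonlinear ones.  Hence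
-- s ≤ a (m + 1 - a) ≤ (m + 1)² / 4.
module Submission where

open import Defs
open import Data.Bool using (Bool; true; false; not; _∧_; _∨_) renaming (_≟_ to _≟ᵇ_)
open import Data.Bool.Properties using (¬-not)
open import Data.Fin using (Fin; zero; suc)
open import Data.Fin.Properties using (any?) renaming (_≟_ to _≟ᶠ_)
open import Data.List using (length; filter; tabulate)
open import Data.Nat using (ℕ; zero; suc; _+_; _*_; _∸_; _^_; _≤_; _≟_; z≤n; s≤s)
open import Data.Nat.Properties
open import Data.Nat.Solver using (module +-*-Solver)
open import Data.Product using (_,_; proj₁; proj₂; ∃-syntax)
open import Data.Sum using (_⊎_; inj₁; inj₂)
open import Data.Vec.Functional using (Vector)
open import Function using (_∘_; id)
open import Relation.Nullary using (¬_; ¬?; does; yes; no)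
open import Relation.Nullary.Negation using (contradiction)
open import Relation.Unary using (Pred; Decidable)
open import Relation.Binary.PropositionalEquality using (_≡_; _≢_; refl; sym; trans; cong; cong₂; subst; subst₂)

open import Algebra.Properties.Semiring.Sum +-*-semiring using (sum; sum-syntax; sum-cong-≗; sum-replicate-zero; sum-remove; ∑-distrib-+; ∑-comm; *-distribʳ-sum)

count : ∀ {n} → (Fin n → Bool) → ℕ
count {n} P = ∑[ i < n ] b2n (P i)

∑-mono-≤ : ∀ {n} {f g : Vector ℕ n} → (∀ i → f i ≤ g i) → sum f ≤ sum g
∑-mono-≤ {zero}  f≤g = z≤n
∑-mono-≤ {suc n} f≤g = +-mono-≤ (f≤g zero) (∑-mono-≤ (f≤g ∘ suc))

term≤∑ : ∀ {n} (f : Vector ℕ n) i → f i ≤ sum f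
term≤∑ {suc n} f i = ≤-trans (m≤m+n (f i) _) (≤-reflexive (sym (sum-remove f)))

count-false : ∀ {n} → count {n} (λ _ → false) ≡ 0
count-false {n} = sum-replicate-zero n

count-true : ∀ {n} → count {n} (λ _ → true) ≡ n
count-true {zero}  = refl
count-true {suc n} = cong suc count-true

count-≟ : ∀ {n} (j : Fin n) → count (λ k → does (k ≟ᶠ j)) ≡ 1
count-≟ {suc n} zero = cong suc (count-false {n})
count-≟ (suc j)      = count-≟ j

length-filter-tabulate : ∀ {a p} {A : Set a} {P : Pred A p} (P? : Decidable P) {n} (f : Fin n → A) →
                         length (filter P? (tabulate f)) ≡ count (λ i → does (P? (f i)))
length-filter-tabulate P? {zero}  f = refl
length-filter-tabulate P? {suc n} f with does (P? (f zero))
... | true  = cong suc (length-filter-tabulate P? (f ∘ suc))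
... | false = length-filter-tabulate P? (f ∘ suc)

count-cover : ∀ {n s} (A : Fin s → Bool) (S : Fin n → Fin s → Bool) →
              (∀ k → A k ≡ true ⊎ ∃[ j ] S j k ≡ true) →
              s ≤ count A + ∑[ j < n ] count (S j)
count-cover {n} {s} A S covered = begin
  s                                                 ≡⟨ count-true ⟨
  count {s} (λ _ → true)                            ≤⟨ ∑-mono-≤ one≤ ⟩
  ∑[ k < s ] (b2n (A k) + ∑[ j < n ] b2n (S j k))
    ≡⟨ ∑-distrib-+ (b2n ∘ A) (λ k → ∑[ j < n ] b2n (S j k)) ⟩
  count A + ∑[ k < s ] ∑[ j < n ] b2n (S j k)       ≡⟨ cong (count A +_) (∑-comm (λ k j → b2n (S j k))) ⟩
  count A + ∑[ j < n ] count (S j)                  ∎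
  where
  open ≤-Reasoning
  one≤ : ∀ k → 1 ≤ b2n (A k) + ∑[ j < n ] b2n (S j k)
  one≤ k with covered k
  ... | inj₁ Ak       rewrite Ak = s≤s z≤n
  ... | inj₂ (j , Sjk) = ≤-trans (≤-trans (≤-reflexive (cong b2n (sym Sjk))) (term≤∑ _ j)) (m≤n+m _ _)

m≤n⇒4*[m*n]≤[m+n]^2 : ∀ {m n} → m ≤ n → 4 * (m * n) ≤ (m + n) ^ 2
m≤n⇒4*[m*n]≤[m+n]^2 {m} m≤n with m≤n⇒∃[o]m+o≡n m≤n
... | d , refl = ≤-trans (m≤m+n _ (d * d)) (≤-reflexive (square-of-sum m d))
  where
  open +-*-Solver
  square-of-sum : ∀ m d → 4 * (m * (m + d)) + d * d ≡ (m + (m + d)) ^ 2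
  square-of-sum = solve 2 (λ m d → con 4 :* (m :* (m :+ d)) :+ d :* d := (m :+ (m :+ d)) :^ 2) refl

4*[m*n]≤[m+n]^2 : ∀ m n → 4 * (m * n) ≤ (m + n) ^ 2
4*[m*n]≤[m+n]^2 m n with ≤-total m n
... | inj₁ m≤n = m≤n⇒4*[m*n]≤[m+n]^2 m≤n
... | inj₂ n≤m = subst₂ (λ x y → 4 * x ≤ y ^ 2) (*-comm n m) (+-comm n m) (m≤n⇒4*[m*n]≤[m+n]^2 n≤m)

4*[m*[n∸m]]≤n^2 : ∀ m n → 4 * (m * (n ∸ m)) ≤ n ^ 2
4*[m*[n∸m]]≤n^2 m n with ≤-total m n
... | inj₁ m≤n = subst (λ k → 4 * (m * (n ∸ m)) ≤ k ^ 2) (m+[n∸m]≡n m≤n) (4*[m*n]≤[m+n]^2 m (n ∸ m))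
... | inj₂ n≤m rewrite m≤n⇒m∸n≡0 n≤m | *-zeroʳ m = z≤n

isNonzero : ℕ → Bool
isNonzero x = does (¬? (x ≟ 0))

numLin≡count : ∀ {s} (p : Poly2 s) → numLin p ≡ count (λ k → isNonzero (Poly2.lin p k))
numLin≡count p = length-filter-tabulate (λ k → ¬? (Poly2.lin p k ≟ 0)) id

isNonzero-b2n+b2n : ∀ a b → b2n (isNonzero (b2n a + b2n b)) ≡ b2n a + b2n (not a ∧ b)
isNonzero-b2n+b2n true  _     = refl
isNonzero-b2n+b2n false true  = refl
isNonzero-b2n+b2n false false = refl

b2n≤1 : ∀ b → b2n b ≤ 1
b2n≤1 true  = ≤-refl
b2n≤1 false = z≤n

b2n+b2n≤1 : ∀ a b → a ∧ b ≢ true → b2n a + b2n b ≤ 1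
b2n+b2n≤1 true  true  a∧b≢true = contradiction refl a∧b≢true
b2n+b2n≤1 true  false _        = ≤-refl
b2n+b2n≤1 false b     _        = b2n≤1 b

module _ {s} (g : G s) where

  nonlinearNeighbour : Fin s → Fin s → Bool
  nonlinearNeighbour j k = G.lin g j ∧ not (G.lin g k) ∧ G.quad g j k

  nonlinearNeighbour-intro : ∀ {i j} → G.lin g i ≡ false → G.lin g j ∧ G.quad g i j ≡ true →
                             nonlinearNeighbour j i ≡ true
  nonlinearNeighbour-intro {i} {j} Li≡false Lj∧qij rewrite Li≡false | G.quad-sym g j i = Lj∧qij

  lin≡false⇒count-nonlinearNeighbour≡0 : ∀ {j} → G.lin g j ≡ false → count (nonlinearNeighbour j) ≡ 0
  lin≡false⇒count-nonlinearNeighbour≡0 {j} Lj≡false =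
    trans (sum-cong-≗ (λ k → cong (λ b → b2n (b ∧ not (G.lin g k) ∧ G.quad g j k)) Lj≡false))
          (count-false {s})

  ¬InG-substOne⇒∃nonlinearNeighbour : ∀ i → G.lin g i ≡ false → ¬ InG (substOne g i) →
                                       ∃[ j ] nonlinearNeighbour j i ≡ true
  ¬InG-substOne⇒∃nonlinearNeighbour i Li≡false gᵢ∉G with any? (λ j → nonlinearNeighbour j i ≟ᵇ true)
  ... | yes found = found
  ... | no none   = contradiction (cong b2n Li≡false , lin≤1 , quad≤1) gᵢ∉G
    where
    lin≤1 : ∀ j → Poly2.lin (substOne g i) j ≤ 1
    lin≤1 j with does (j ≟ᶠ i)
    ... | true  = z≤n
    ... | false = b2n+b2n≤1 (G.lin g j) (G.quad g i j) (λ e → none (j , nonlinearNeighbour-intro Li≡false e))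
    quad≤1 : ∀ j k → Poly2.quad (substOne g i) j k ≤ 1
    quad≤1 j k with does (j ≟ᶠ i) ∨ does (k ≟ᶠ i)
    ... | true  = z≤n
    ... | false = b2n≤1 (G.quad g j k)

  count-lin+count-nonlinearNeighbour≤1+numLin :
    ∀ j → G.lin g j ≡ true → count (G.lin g) + count (nonlinearNeighbour j) ≤ suc (numLin (substOne g j))
  count-lin+count-nonlinearNeighbour≤1+numLin j Lj≡true = begin
    count (G.lin g) + count (nonlinearNeighbour j)
      ≡⟨ ∑-distrib-+ (b2n ∘ G.lin g) (b2n ∘ nonlinearNeighbour j) ⟨
    ∑[ k < s ] (b2n (G.lin g k) + b2n (nonlinearNeighbour j k))
      ≤⟨ ∑-mono-≤ pointwise ⟩
    ∑[ k < s ] (b2n (does (k ≟ᶠ j)) + b2n (isNonzero (Poly2.lin (substOne g j) k)))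
      ≡⟨ ∑-distrib-+ (λ k → b2n (does (k ≟ᶠ j))) (λ k → b2n (isNonzero (Poly2.lin (substOne g j) k))) ⟩
    count (λ k → does (k ≟ᶠ j)) + count (λ k → isNonzero (Poly2.lin (substOne g j) k))
      ≡⟨ cong₂ _+_ (sym (count-≟ j)) (numLin≡count (substOne g j)) ⟨
    suc (numLin (substOne g j)) ∎
    where
    open ≤-Reasoning
    pointwise : ∀ k → b2n (G.lin g k) + b2n (nonlinearNeighbour j k)
                      ≤ b2n (does (k ≟ᶠ j)) + b2n (isNonzero (Poly2.lin (substOne g j) k))
    pointwise k with k ≟ᶠ j
    ... | yes refl rewrite Lj≡true = ≤-refl
    ... | no _     rewrite Lj≡true = ≤-reflexive (sym (isNonzero-b2n+b2n (G.lin g k) (G.quad g j k)))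

module _ {m s} (g : G s) (g∈𝒢m : InGm m g) where

  linear-or-nonlinearNeighbour : ∀ k → G.lin g k ≡ true ⊎ ∃[ j ] nonlinearNeighbour g j k ≡ true
  linear-or-nonlinearNeighbour k with G.lin g k ≟ᵇ true
  ... | yes Lk≡true = inj₁ Lk≡true
  ... | no  Lk≢true = inj₂ (¬InG-substOne⇒∃nonlinearNeighbour g k (¬-not Lk≢true) (proj₁ (g∈𝒢m k)))

  1+count-nonlinearNeighbour≤1+m∸count-lin :
    ∀ j → G.lin g j ≡ true → suc (count (nonlinearNeighbour g j)) ≤ suc m ∸ count (G.lin g)
  1+count-nonlinearNeighbour≤1+m∸count-lin j Lj≡true = m+n≤o⇒m≤o∸n (suc c) (s≤s (begin
    c + a                       ≡⟨ +-comm c a ⟩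
    a + c                       ≤⟨ count-lin+count-nonlinearNeighbour≤1+numLin g j Lj≡true ⟩
    suc (numLin (substOne g j)) ≤⟨ proj₂ (g∈𝒢m j) ⟩
    m                           ∎))
    where
    open ≤-Reasoning
    a c : ℕ
    a = count (G.lin g)
    c = count (nonlinearNeighbour g j)

  b2n-lin+count-nonlinearNeighbour≤b2n-lin*[1+m∸count-lin] :
    ∀ j → b2n (G.lin g j) + count (nonlinearNeighbour g j) ≤ b2n (G.lin g j) * (suc m ∸ count (G.lin g))
  b2n-lin+count-nonlinearNeighbour≤b2n-lin*[1+m∸count-lin] j = by-linearity (G.lin g j) refl
    where
    -- A plain `with G.lin g j` would also abstract the occurrence hidden inside
    -- nonlinearNeighbour g j, so the linear case could no longer use the lemma above.
    by-linearity : ∀ b → G.lin g j ≡ b →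
                   b2n b + count (nonlinearNeighbour g j) ≤ b2n b * (suc m ∸ count (G.lin g))
    by-linearity false Lj≡false = ≤-reflexive (lin≡false⇒count-nonlinearNeighbour≡0 g Lj≡false)
    by-linearity true  Lj≡true  =
      ≤-trans (1+count-nonlinearNeighbour≤1+m∸count-lin j Lj≡true) (≤-reflexive (sym (+-identityʳ _)))

  s≤count-lin*[1+m∸count-lin] : s ≤ count (G.lin g) * (suc m ∸ count (G.lin g))
  s≤count-lin*[1+m∸count-lin] = begin
    s
      ≤⟨ count-cover (G.lin g) (nonlinearNeighbour g) linear-or-nonlinearNeighbour ⟩
    a + ∑[ j < s ] count (nonlinearNeighbour g j)
      ≡⟨ ∑-distrib-+ (b2n ∘ G.lin g) (count ∘ nonlinearNeighbour g) ⟨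
    ∑[ j < s ] (b2n (G.lin g j) + count (nonlinearNeighbour g j))
      ≤⟨ ∑-mono-≤ b2n-lin+count-nonlinearNeighbour≤b2n-lin*[1+m∸count-lin] ⟩
    ∑[ j < s ] (b2n (G.lin g j) * (suc m ∸ a))
      ≡⟨ *-distribʳ-sum (suc m ∸ a) (b2n ∘ G.lin g) ⟨
    a * (suc m ∸ a) ∎
    where
    open ≤-Reasoning
    a : ℕ
    a = count (G.lin g)

lemma6p5 : ∀ (m s : ℕ) (g : G s) → 1 ≤ s → InGm m g → 4 * s ≤ (m + 1) ^ 2
lemma6p5 m s g _ g∈𝒢m = begin
  4 * s                  ≤⟨ *-monoʳ-≤ 4 (s≤count-lin*[1+m∸count-lin] {m} g g∈𝒢m) ⟩
  4 * (a * (suc m ∸ a))  ≤⟨ 4*[m*[n∸m]]≤n^2 a (suc m) ⟩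
  suc m ^ 2              ≡⟨ cong (_^ 2) (+-comm 1 m) ⟩
  (m + 1) ^ 2            ∎
  where
  open ≤-Reasoning
  a : ℕ
  a = count (G.lin g)
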